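{- If $t$ is a term and $x\in TV(t)$, then $no(x,t)=1$.
   Context: Pseudo-terms are given by the grammar $t ::= x \mid \lambda x.t \mid (t\,t') \mid\, !t \mid \mathrm{let}\ t\ \mathrm{be}\ !x\ \mathrm{in}\ t'$. In $\mathrm{let}\ u\ \mathrm{be}\ !x\ \mathrm{in}\ t_1$ the variable $x$ is bound in $t_1$: $FV(\mathrm{let}\ u\ \mathrm{be}\ !x\ \mathrm{in}\ t_1)=FV(u)\cup(FV(t_1)\setminus\{x\})$; $\lambda$ binds as usual. $FV(t)$ is the set of free variables of $t$, and $no(x,t)$ is the number of free occurrences of $x$ in $t$. Terms and their sets of temporary variables $TV(t)\subseteq FV(t)$ are defined simultaneously as the smallest set of pseudo-terms such that: (i) a variable $x$ is a term, $TV(x)=\emptyset$; (ii) $\lambda x.t$ is a term iff $t$ is a term, $x\notin TV(t)$ and $no(x,t)\le 1$, and then $TV(\lambda x.t)=TV(t)$; (iii) $(t_1\,t_2)$ is a term iff $t_1,t_2$ are terms, $TV(t_1)\cap FV(t_2)=\emptyset$ and $FV(t_1)\cap TV(t_2)=\emptyset$, and then $TV(t_1\,t_2)=TV(t_1)\cup TV(t_2)$; (iv) $!t$ is a term iff $t$ is a term, $TV(t)=\emptyset$ and $no(x,t)=1$ for all $x\in FV(t)$, and then $TV(!t)=FV(t)$; (v) $\mathrm{let}\ t_1\ \mathrm{be}\ !x\ \mathrm{in}\ t_2$ is a term iff $t_1,t_2$ are terms, $TV(t_1)\cap FV(t_2)=\emptyset$ and $FV(t_1)\cap TV(t_2)=\emptyset$,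 and then its $TV$ is $TV(t_1)\cup(TV(t_2)\setminus\{x\})$. -}

module Defs where

open import Data.Nat using (ℕ; zero; suc; _+_; _≟_; _≤_)
open import Data.List using (List; []; _∷_; _++_; filter)
open import Data.List.Membership.Propositional using (_∈_; _∉_)
open import Relation.Nullary using (¬_)
import Relation.Nullary as N
open import Relation.Nullary.Decidable using (¬?)
open import Relation.Binary.PropositionalEquality using (_≡_)

Var : Set
Var = ℕ

data PTerm : Set where
  var  : Var → PTerm
  lam  : Var → PTerm → PTerm
  app  : PTerm → PTerm → PTerm
  bang : PTerm → PTerm
  letb : PTerm → Var → PTerm → PTerm   -- letb u x t  =  let u be !x in t

_∖_ : List Var → Var → List Var
xs ∖ x = filter (λ y → ¬? (y ≟ x)) xs

-- free variables (as a list, possibly with repetitions; read as a set via ∈)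
FV : PTerm → List Var
FV (var y)      = y ∷ []
FV (lam y t)    = FV t ∖ y
FV (app t u)    = FV t ++ FV u
FV (bang t)     = FV t
FV (letb u y t) = FV u ++ (FV t ∖ y)

no : Var → PTerm → ℕ
no x (var y) with x ≟ y
... | N.yes _ = 1
... | N.no _  = 0
no x (lam y t) with x ≟ y
... | N.yes _ = 0
... | N.no _  = no x t
no x (app t u) = no x t + no x u
no x (bang t) = no x t
no x (letb u y t) with x ≟ y
... | N.yes _ = no x u
... | N.no _  = no x u + no x t

TV : PTerm → List Var
TV (var y)      = []
TV (lam y t)    = TV t
TV (app t u)    = TV t ++ TV u
TV (bang t)     = FV t
TV (letb u y t) = TV u ++ (TV t ∖ y)

Disjoint : List Var → List Var → Set
Disjoint A B = ∀ z → z ∈ A → z ∉ B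

data IsTerm : PTerm → Set where
  t-var  : ∀ x → IsTerm (var x)
  t-lam  : ∀ x t → IsTerm t → x ∉ TV t → no x t ≤ 1 → IsTerm (lam x t)
  t-app  : ∀ t₁ t₂ → IsTerm t₁ → IsTerm t₂ →
           Disjoint (TV t₁) (FV t₂) → Disjoint (FV t₁) (TV t₂) → IsTerm (app t₁ t₂)
  t-bang : ∀ t → IsTerm t → TV t ≡ [] → (∀ x → x ∈ FV t → no x t ≡ 1) → IsTerm (bang t)
  t-let  : ∀ t₁ x t₂ → IsTerm t₁ → IsTerm t₂ →
           Disjoint (TV t₁) (FV t₂) → Disjoint (FV t₁) (TV t₂) → IsTerm (letb t₁ x t₂)

{-# OPTIONS --safe #-}
module Submission where

-- A temporary variable is introduced
-- by !t, whose formation rule already demands exactly one occurrence of it; λ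
-- and let only pass temporary variables through.  In an application or a let,
-- a temporary variable of one part is, by the disjointness side conditions,
-- not free in the other part, which therefore contributes no occurrence.

open import Defs
open import Data.Empty using (⊥-elim)
open import Data.List using (List)
open import Data.List.Membership.Propositional using (_∈_; _∉_)
open import Data.List.Membership.Propositional.Properties
  using (∈-filter⁺; ∈-filter⁻; ∈-++⁺ˡ; ∈-++⁺ʳ; ∈-++⁻)
open import Data.List.Relation.Unary.Any using (here)
open import Data.Nat using (_+_; _≟_)
open import Data.Product using (_×_; proj₁; proj₂)
open import Data.Sum using (inj₁; inj₂)
open import Relation.Binary.PropositionalEquality using (_≡_; _≢_; refl; cong₂)
import Relation.Nullary as Dec
open import Relation.Nullary.Decidable using (¬?)

∈-∖⁺ : ∀ {x y} (xs : List Var) → x ∈ xs → x ≢ y → x ∈ xs ∖ y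
∈-∖⁺ {y = y} _ = ∈-filter⁺ (λ z → ¬? (z ≟ y))

∈-∖⁻ : ∀ {x y} (xs : List Var) → x ∈ xs ∖ y → x ∈ xs × x ≢ y
∈-∖⁻ {y = y} xs = ∈-filter⁻ (λ z → ¬? (z ≟ y)) {xs = xs}

∉FV⇒no≡0 : ∀ x t → x ∉ FV t → no x t ≡ 0
∉FV⇒no≡0 x (var y) x∉ with x ≟ y
... | Dec.yes refl = ⊥-elim (x∉ (here refl))
... | Dec.no _     = refl
∉FV⇒no≡0 x (lam y t) x∉ with x ≟ y
... | Dec.yes _  = refl
... | Dec.no x≢y = ∉FV⇒no≡0 x t (λ x∈ → x∉ (∈-∖⁺ (FV t) x∈ x≢y))
∉FV⇒no≡0 x (app t u) x∉ =
  cong₂ _+_ (∉FV⇒no≡0 x t (λ x∈ → x∉ (∈-++⁺ˡ x∈)))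
            (∉FV⇒no≡0 x u (λ x∈ → x∉ (∈-++⁺ʳ (FV t) x∈)))
∉FV⇒no≡0 x (bang t) x∉ = ∉FV⇒no≡0 x t x∉
∉FV⇒no≡0 x (letb u y t) x∉ with x ≟ y
... | Dec.yes _  = ∉FV⇒no≡0 x u (λ x∈ → x∉ (∈-++⁺ˡ x∈))
... | Dec.no x≢y =
  cong₂ _+_ (∉FV⇒no≡0 x u (λ x∈ → x∉ (∈-++⁺ˡ x∈)))
            (∉FV⇒no≡0 x t (λ x∈ → x∉ (∈-++⁺ʳ (FV u) (∈-∖⁺ (FV t) x∈ x≢y))))

mainTheorem7 : (t : PTerm) → IsTerm t → (x : Var) → x ∈ TV t → no x t ≡ 1
mainTheorem7 (var y) _ x ()
mainTheorem7 (lam y t) (t-lam _ _ ⊢t y∉TVt _) x x∈TVt with x ≟ y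
... | Dec.yes refl = ⊥-elim (y∉TVt x∈TVt)
... | Dec.no _     = mainTheorem7 t ⊢t x x∈TVt
mainTheorem7 (app t u) (t-app _ _ ⊢t ⊢u TVt#FVu FVt#TVu) x x∈TV with ∈-++⁻ (TV t) x∈TV
... | inj₁ x∈TVt = cong₂ _+_ (mainTheorem7 t ⊢t x x∈TVt) (∉FV⇒no≡0 x u (TVt#FVu x x∈TVt))
... | inj₂ x∈TVu = cong₂ _+_ (∉FV⇒no≡0 x t (λ x∈FVt → FVt#TVu x x∈FVt x∈TVu))
                            (mainTheorem7 u ⊢u x x∈TVu)
mainTheorem7 (bang t) (t-bang _ _ _ linear) x x∈FVt = linear x x∈FVt
mainTheorem7 (letb u y t) (t-let _ _ _ ⊢u ⊢t TVu#FVt FVu#TVt) x x∈TV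
  with x ≟ y | ∈-++⁻ (TV u) x∈TV
... | Dec.yes _   | inj₁ x∈TVu   = mainTheorem7 u ⊢u x x∈TVu
... | Dec.no _    | inj₁ x∈TVu   =
  cong₂ _+_ (mainTheorem7 u ⊢u x x∈TVu) (∉FV⇒no≡0 x t (TVu#FVt x x∈TVu))
... | Dec.yes x≡y | inj₂ x∈TVt∖y = ⊥-elim (proj₂ (∈-∖⁻ (TV t) x∈TVt∖y) x≡y)
... | Dec.no _    | inj₂ x∈TVt∖y =
  cong₂ _+_ (∉FV⇒no≡0 x u (λ x∈FVu → FVu#TVt x x∈FVu x∈TVt)) (mainTheorem7 t ⊢t x x∈TVt)
  where
  x∈TVt : x ∈ TV t
  x∈TVt = proj₁ (∈-∖⁻ (TV t) x∈TVt∖y)
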